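{- The equivalence $\mathbf F_p(\varphi\vee\psi)\equiv\mathbf F_p\varphi\vee\mathbf F_p\psi$ does not hold in general under lax multiteam semantics: there exist a rational $p\in[0,1]$, first-order formulas $\varphi,\psi$, a multistructure $\mathfrak A$ and a multiteam $(X,m)$ over $\mathfrak A$ such that $\mathfrak A\models_{(X,m)}\mathbf F_p(\varphi\vee\psi)$ but $\mathfrak A\not\models_{(X,m)}\mathbf F_p\varphi\vee\mathbf F_p\psi$.
   Context: Multisets: a multiset is a pair $(A,m)$ with $m:A\to\mathbb N$ (multiplicity $0$ allowed); all multisets are finite. Canonical set representative: $\{(a,i):a\in A,0<i\le m(a)\}$; $(A,m)\subseteq(B,n)$ iff canonical representative of $(A,m)$ is a subset of that of $(B,n)$; $|(A,m)|=\sum_a m(a)$; $(A,m)\uplus(B,n)=(A\cup B,k)$ with $k$ the sum of multiplicities. An assignment is a function $s:D\to A$ from a finite set of variables; a team is a finite set of assignments with common domain and codomain; a multiteam is a multiset $(X,m)$ with $X$ a team. A $\tau$-multistructure is $\mathfrak A=((A,n),(R^{\mathfrak A})_{R\in\tau})$, $(A,n)$ a finite multiset, $R^{\mathfrak A}$ relations on $\{a:n(a)\ge1\}$; multiteams over $\mathfrak A$ have codomain $A$. Lax multiteam semantics of first-order formulas (negation normal form): literals ($x=y$, $x\neq y$, $R(\vec x)$, $\neg R(\vec x)$) hold iff every $s\in X$ with $m(s)\ge1$ satisfies them classically; $\wedge$ classical; $\psi\vee\theta$ holds in $(X,m)$ iff $(Y,k)\models\psi$ and $(Z,l)\models\theta$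 for some $(Y,k),(Z,l)\subseteq(X,m)$ with $(X,m)\subseteq(Y,k)\uplus(Z,l)$; quantifiers are interpreted as in lax multiteam semantics (not needed beyond quantifier-free formulas here). Approximation operator: for rational $p\in[0,1]$, $\mathfrak A\models_{(X,m)}\mathbf F_p\varphi$ iff there is $(Y,k)\subseteq(X,m)$ with $|(Y,k)|\ge p\cdot|(X,m)|$ and $\mathfrak A\models_{(Y,k)}\varphi$. -}

module Defs where

open import Data.Nat using (ℕ; zero; suc; _+_) renaming (_≤_ to _≤ℕ_)
open import Data.Fin using (Fin)
open import Data.Vec using (Vec; []; _∷_; lookup; map)
open import Data.Vec.Relation.Unary.All using (All)
open import Data.List using (List; [_]; concatMap; allFin) renaming (map to mapL)
open import Data.Nat.ListAction using (sum)
open import Data.Empty using (⊥)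
open import Data.Integer using (+_)
open import Data.Rational using (ℚ; _/_; _*_; _≤_)
open import Data.Product using (Σ; _×_; ∃; ∃-syntax)
open import Relation.Binary.PropositionalEquality using (_≡_; _≢_)
open import Level using (Level; suc; _⊔_) renaming (zero to lzero)

ℕ→ℚ : ℕ → ℚ
ℕ→ℚ n = (+ n) / 1

record Vocabulary : Set where
  field
    nRel  : ℕ
    arity : Fin nRel → ℕ
open Vocabulary public

-- τ-multistructures: universe multiset (Fin N, mult) ; relations live on
-- the elements of multiplicity ≥ 1.

record MultiStructure (τ : Vocabulary) : Set₁ where
  field
    N     : ℕ
    mult  : Fin N → ℕ
    relA  : (R : Fin (nRel τ)) → Vec (Fin N) (arity τ R) → Set
    relWF : (R : Fin (nRel τ)) (as : Vec (Fin N) (arity τ R)) →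
            relA R as → All (λ a → 1 ≤ℕ mult a) as
open MultiStructure public

-- Assignments with domain {x_0,…,x_{k-1}} into Fin N, and multiteams
-- as multiplicity functions on all assignments (multiplicity 0 allowed).

Assignment : ℕ → ℕ → Set
Assignment N k = Vec (Fin N) k

allAssignments : (N k : ℕ) → List (Assignment N k)
allAssignments N zero    = [ [] ]
allAssignments N (suc k) =
  concatMap (λ a → mapL (a ∷_) (allAssignments N k)) (allFin N)

MultiTeam : ℕ → ℕ → Set
MultiTeam N k = Assignment N k → ℕ

_⊆_ : ∀ {N k} → MultiTeam N k → MultiTeam N k → Set
Y ⊆ X = ∀ s → Y s ≤ℕ X s

_⊎_ : ∀ {N k} → MultiTeam N k → MultiTeam N k → MultiTeam N k
(Y ⊎ Z) s = Y s + Z s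

∣_∣ : ∀ {N k} → MultiTeam N k → ℕ
∣_∣ {N} {k} X = sum (mapL X (allAssignments N k))

-- Formulas in negation normal form over variables Fin k, extended with
-- the approximation operator F_p.  (Quantifier-free.)

data Formula (τ : Vocabulary) (k : ℕ) : Set where
  eq   : Fin k → Fin k → Formula τ k
  neq  : Fin k → Fin k → Formula τ k
  rel  : (R : Fin (nRel τ)) → Vec (Fin k) (arity τ R) → Formula τ k
  nrel : (R : Fin (nRel τ)) → Vec (Fin k) (arity τ R) → Formula τ k
  _∧ᶠ_ : Formula τ k → Formula τ k → Formula τ k
  _∨ᶠ_ : Formula τ k → Formula τ k → Formula τ k
  𝐅    : ℚ → Formula τ k → Formula τ k

data FirstOrder {τ : Vocabulary} {k : ℕ} : Formula τ k → Set where
  eq   : ∀ x y → FirstOrder (eq x y)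
  neq  : ∀ x y → FirstOrder (neq x y)
  rel  : ∀ R xs → FirstOrder (rel R xs)
  nrel : ∀ R xs → FirstOrder (nrel R xs)
  _∧ᶠ_ : ∀ {φ ψ} → FirstOrder φ → FirstOrder ψ → FirstOrder (φ ∧ᶠ ψ)
  _∨ᶠ_ : ∀ {φ ψ} → FirstOrder φ → FirstOrder ψ → FirstOrder (φ ∨ᶠ ψ)

Sat : ∀ {τ k} (𝔄 : MultiStructure τ) → Formula τ k → MultiTeam (N 𝔄) k → Set
Sat 𝔄 (eq x y)   X = ∀ s → 1 ≤ℕ X s → lookup s x ≡ lookup s y
Sat 𝔄 (neq x y)  X = ∀ s → 1 ≤ℕ X s → lookup s x ≢ lookup s y
Sat 𝔄 (rel R xs)  X = ∀ s → 1 ≤ℕ X s → relA 𝔄 R (map (lookup s) xs)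
Sat 𝔄 (nrel R xs) X = ∀ s → 1 ≤ℕ X s → (relA 𝔄 R (map (lookup s) xs) → ⊥)
Sat 𝔄 (φ ∧ᶠ ψ) X = Sat 𝔄 φ X × Sat 𝔄 ψ X
Sat 𝔄 (φ ∨ᶠ ψ) X = ∃[ Y ] ∃[ Z ] (Y ⊆ X × Z ⊆ X × X ⊆ (Y ⊎ Z) × Sat 𝔄 φ Y × Sat 𝔄 ψ Z)
Sat 𝔄 (𝐅 p φ)  X = ∃[ Y ] (Y ⊆ X × p * ℕ→ℚ ∣ X ∣ ≤ ℕ→ℚ ∣ Y ∣ × Sat 𝔄 φ Y)

module Submission where

-- Counterexample, with p = 2/3.  The universe is {a₀, a₁, a₂} (each
-- element once), with unary predicates P₀ = {a₀} and P₁ = {a₁}; X is the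
-- multiteam containing each of the three assignments x ↦ aⱼ once.
--
-- * F_p(P₀x ∨ P₁x) holds: the subteam {x↦a₀, x↦a₁} has 2 = p·3 elements
--   and splits into a P₀-part and a P₁-part.
-- * F_p(P₀x) ∨ F_p(P₁x) fails: in any split X ⊆ Y ⊎ Z the assignment
--   x↦a₂ lies in the part W meant for some Pᵢ.  A subteam of W satisfying
--   Pᵢx lives on x↦aᵢ only, so it has at most W(x↦aᵢ) = c ≤ 1 elements,
--   while |W| ≥ c + 1; and no c ≤ 1 satisfies (2/3)(c + 1) ≤ c.

open import Defs
open import Data.Nat as ℕ using (zero; suc; z≤n; s≤s; _+_)
open import Data.Nat.Properties as ℕ using (+-identityʳ; +-monoʳ-≤; m≤m+n; m≤n+m)
import Data.Integer as ℤ
import Data.Integer.Properties as ℤ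
open import Data.Rational using (ℚ; mkℚ; 0ℚ; 1ℚ; *≤*; _≤_; _≤?_; _/_; _*_)
open import Data.Rational.Properties using (normalize-coprime; ≤-trans; *-monoˡ-≤-nonNeg)
open import Data.Nat.Coprimality as Coprime using (1-coprimeTo)
open import Data.Fin as Fin using (Fin; zero; suc; inject₁)
open import Data.Vec using ([]; _∷_; map; lookup)
open import Data.Vec.Relation.Unary.All using ([]; _∷_)
open import Data.Product using (Σ; _×_; ∃; ∃-syntax; _,_)
open import Data.Sum using (inj₁; inj₂) renaming (_⊎_ to _⊎ˢ_)
open import Relation.Nullary using (¬_; yes; no; contradiction)
open import Relation.Nullary.Decidable using (True; False; toWitness; toWitnessFalse)
open import Relation.Binary.PropositionalEquality using (_≡_; refl; sym; cong; subst; subst₂)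

≤-by-evaluation : ∀ {q r} {holds : True (q ≤? r)} → q ≤ r
≤-by-evaluation {holds = holds} = toWitness holds

≰-by-evaluation : ∀ {q r} {fails : False (q ≤? r)} → ¬ q ≤ r
≰-by-evaluation {fails = fails} = toWitnessFalse fails

ℕ→ℚ-canonical : ∀ n → ℕ→ℚ n ≡ mkℚ (ℤ.+ n) 0 (Coprime.sym (1-coprimeTo n))
ℕ→ℚ-canonical n = normalize-coprime (Coprime.sym (1-coprimeTo n))

ℕ→ℚ-mono : ∀ {m n} → m ℕ.≤ n → ℕ→ℚ m ≤ ℕ→ℚ n
ℕ→ℚ-mono {m} {n} m≤n
  rewrite ℕ→ℚ-canonical m | ℕ→ℚ-canonical n =
  *≤* (subst₂ ℤ._≤_ (sym (ℤ.*-identityʳ (ℤ.+ m))) (sym (ℤ.*-identityʳ (ℤ.+ n))) (ℤ.+≤+ m≤n))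

atom-support : ∀ {τ k} (𝔄 : MultiStructure τ) {R xs} (W : MultiTeam (N 𝔄) k) s →
               Sat 𝔄 (rel R xs) W → ¬ relA 𝔄 R (map (lookup s) xs) →
               W s ≡ 0
atom-support 𝔄 W s sat violated with W s in eq
... | zero  = refl
... | suc _ = contradiction (sat s (subst (1 ℕ.≤_) (sym eq) (s≤s z≤n))) violated

positive-summand : ∀ y z → 1 ℕ.≤ y + z → 1 ℕ.≤ y ⊎ˢ 1 ℕ.≤ z
positive-summand zero    z z≥1 = inj₂ z≥1
positive-summand (suc y) z _   = inj₁ (s≤s z≤n)

p : ℚ
p = (ℤ.+ 2) / 3

too-small-for-p : ∀ {c n m} → c ℕ.≤ 1 → c + 1 ℕ.≤ n → m ℕ.≤ c →
                  ¬ p * ℕ→ℚ n ≤ ℕ→ℚ m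
too-small-for-p {c} c≤1 c+1≤n m≤c large =
  no-fixpoint c≤1 (≤-trans (*-monoˡ-≤-nonNeg p (ℕ→ℚ-mono c+1≤n))
                           (≤-trans large (ℕ→ℚ-mono m≤c)))
  where
  no-fixpoint : ∀ {c} → c ℕ.≤ 1 → ¬ p * ℕ→ℚ (c + 1) ≤ ℕ→ℚ c
  no-fixpoint z≤n       = ≰-by-evaluation
  no-fixpoint (s≤s z≤n) = ≰-by-evaluation

τ : Vocabulary
τ = record { nRel = 2 ; arity = λ _ → 1 }

𝔄 : MultiStructure τ
𝔄 = record
  { N     = 3
  ; mult  = λ _ → 1
  ; relA  = λ { i (a ∷ []) → a ≡ inject₁ i }
  ; relWF = λ { i (a ∷ []) _ → s≤s z≤n ∷ [] }
  }

point : Fin 2 → Fin 3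
point = inject₁

a₂ : Fin 3
a₂ = suc (suc zero)

x↦_ : Fin 3 → Assignment 3 1
x↦ a = a ∷ []

P : Fin 2 → Formula τ 1
P i = rel i (zero ∷ [])

X : MultiTeam 3 1
X _ = 1

size-of-P-team : ∀ i (W : MultiTeam 3 1) → Sat 𝔄 (P i) W → ∣ W ∣ ≡ W (x↦ point i)
size-of-P-team zero W sat
  rewrite atom-support 𝔄 W (x↦ suc zero) sat (λ ())
        | atom-support 𝔄 W (x↦ a₂) sat (λ ()) = +-identityʳ (W (x↦ zero))
size-of-P-team (suc zero) W sat
  rewrite atom-support 𝔄 W (x↦ zero) sat (λ ())
        | atom-support 𝔄 W (x↦ a₂) sat (λ ()) = +-identityʳ (W (x↦ suc zero))

size-lower-bound : ∀ i (W : MultiTeam 3 1) → W (x↦ point i) + W (x↦ a₂) ℕ.≤ ∣ W ∣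
size-lower-bound zero W = +-monoʳ-≤ (W (x↦ zero)) (begin
  W (x↦ a₂)                             ≡⟨ +-identityʳ (W (x↦ a₂)) ⟨
  W (x↦ a₂) + 0                         ≤⟨ m≤n+m (W (x↦ a₂) + 0) (W (x↦ suc zero)) ⟩
  W (x↦ suc zero) + (W (x↦ a₂) + 0)     ∎)
  where open ℕ.≤-Reasoning
size-lower-bound (suc zero) W = begin
  W (x↦ suc zero) + W (x↦ a₂)           ≡⟨ cong (W (x↦ suc zero) +_) (+-identityʳ (W (x↦ a₂))) ⟨
  W (x↦ suc zero) + (W (x↦ a₂) + 0)     ≤⟨ m≤n+m _ (W (x↦ zero)) ⟩
  ∣ W ∣                                 ∎
  where open ℕ.≤-Reasoning

part-with-a₂-fails : ∀ i (W : MultiTeam 3 1) → W ⊆ X → 1 ℕ.≤ W (x↦ a₂) →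
                     ¬ Sat 𝔄 (𝐅 p (P i)) W
part-with-a₂-fails i W W⊆X a₂∈W (W′ , W′⊆W , large , sat) =
  too-small-for-p (W⊆X (x↦ point i))
    (ℕ.≤-trans (+-monoʳ-≤ (W (x↦ point i)) a₂∈W) (size-lower-bound i W))
    (subst (ℕ._≤ _) (sym (size-of-P-team i W′ sat)) (W′⊆W (x↦ point i)))
    large

split-fails : ¬ Sat 𝔄 (𝐅 p (P zero) ∨ᶠ 𝐅 p (P (suc zero))) X
split-fails (Y , Z , Y⊆X , Z⊆X , X⊆Y⊎Z , satY , satZ)
  with positive-summand (Y (x↦ a₂)) (Z (x↦ a₂)) (X⊆Y⊎Z (x↦ a₂))
... | inj₁ a₂∈Y = part-with-a₂-fails zero Y Y⊆X a₂∈Y satY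
... | inj₂ a₂∈Z = part-with-a₂-fails (suc zero) Z Z⊆X a₂∈Z satZ

singleton : Fin 3 → MultiTeam 3 1
singleton a (b ∷ []) with a Fin.≟ b
... | yes _ = 1
... | no  _ = 0

-- The singleton team of x ↦ aᵢ satisfies Pᵢ x (off aᵢ the multiplicity
-- is 0, so the hypothesis 1 ≤ 0 rules that case out).
singleton-sat : ∀ i → Sat 𝔄 (P i) (singleton (point i))
singleton-sat i (b ∷ []) in-support with point i Fin.≟ b
... | yes aᵢ≡b = sym aᵢ≡b

X₀₁ : MultiTeam 3 1
X₀₁ = singleton zero ⊎ singleton (suc zero)

X₀₁⊆X : X₀₁ ⊆ X
X₀₁⊆X (zero ∷ [])             = s≤s z≤n
X₀₁⊆X (suc zero ∷ [])         = s≤s z≤n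
X₀₁⊆X (suc (suc zero) ∷ [])   = z≤n

disjunction-approximated : Sat 𝔄 (𝐅 p (P zero ∨ᶠ P (suc zero))) X
disjunction-approximated =
  X₀₁ , X₀₁⊆X , ≤-by-evaluation ,
  singleton zero , singleton (suc zero) ,
  (λ _ → m≤m+n _ _) , (λ _ → m≤n+m _ _) , (λ _ → ℕ.≤-refl) ,
  singleton-sat zero , singleton-sat (suc zero)

proposition9 :
    ∃[ p ] (0ℚ ≤ p × p ≤ 1ℚ ×
      ∃[ τ ] ∃[ k ] Σ (Formula τ k) λ φ → Σ (Formula τ k) λ ψ →
        FirstOrder φ × FirstOrder ψ ×
        Σ (MultiStructure τ) λ 𝔄 → Σ (MultiTeam (N 𝔄) k) λ X →
          Sat 𝔄 (𝐅 p (φ ∨ᶠ ψ)) X × ¬ Sat 𝔄 (𝐅 p φ ∨ᶠ 𝐅 p ψ) X)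
proposition9 =
  p , ≤-by-evaluation , ≤-by-evaluation ,
  τ , 1 , P zero , P (suc zero) , rel _ _ , rel _ _ ,
  𝔄 , X , disjunction-approximated , split-fails
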